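{- Let $(X,\xi)$ be an $F$-coalgebra and $\epsilon,\delta\in\mathcal V$ with $\delta\le\epsilon$. Then for every $x\in X$ and every two-valued formula $\phi$, $$x\models_\epsilon\phi\iff x\models_{\epsilon-\delta}r_\delta(\phi).$$
   Context: Let $\mathcal V=[0,1]$, and let $q\ominus\epsilon=\max(q-\epsilon,0)$. Let $F$ be a set functor and $\Lambda$ a set of monotone $2$-to-$\mathcal V$ predicate liftings, i.e. natural families $\lambda_X\colon2^X\to\mathcal V^{FX}$ monotone in $A$. Two-valued formulae: $\phi::=\bot\mid\top\mid\phi\wedge\phi\mid\phi\vee\phi\mid\lambda_q\phi$ ($\lambda\in\Lambda$, $q\in\mathcal V$). Satisfaction up to $\epsilon$ in a coalgebra $\xi\colon X\to FX$: - $x\models_\epsilon\top$ and $x\not\models_\epsilon\bot$; - conjunction and disjunction are standard; - $x\models_\epsilon\lambda_q\phi$ iff $\lambda_X(\{z\mid z\models_\epsilon\phi\})(\xi(x))\ge q\ominus\epsilon$. The $\delta$-relaxation $r_\delta(\phi)$ is defined recursively by $r_\delta(\lambda_q\phi)=\lambda_{q\ominus\delta}r_\delta(\phi)$, commuting with $\top,\bot,\wedge,\vee$. -}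

module Defs where

open import Level using (0ℓ)
open import Data.Bool using (Bool; true; false)
open import Data.Product using (Σ; _×_; _,_; proj₁; proj₂)
open import Data.Sum using (inj₁; inj₂)
open import Function using (id; _∘_)
open import Relation.Nullary using (¬_; yes; no)
open import Relation.Nullary.Decidable using (⌊_⌋)
open import Relation.Binary.Core using (Rel)
open import Relation.Binary.Definitions using (Decidable)
open import Relation.Binary.Structures using (IsTotalOrder)
open import Relation.Binary.PropositionalEquality using (_≡_; _≢_; refl; subst; sym)
open import Algebra.Structures using (IsCommutativeRing)

-- Every model is
-- (isomorphic to) ℝ, so quantifying over all models is quantifying over ℝ.
record Reals : Set₁ where
  infixl 6 _+_
  infixl 7 _*_
  infix 4 _≤_
  field
    ℝ : Set
    _+_ _*_ : ℝ → ℝ → ℝ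
    -_ : ℝ → ℝ
    0# 1# : ℝ
    _≤_ : ℝ → ℝ → Set
    isCommutativeRing : IsCommutativeRing _≡_ _+_ _*_ -_ 0# 1#
    0≢1 : 0# ≢ 1#
    *-inverse : ∀ x → x ≢ 0# → Σ ℝ (λ y → x * y ≡ 1#)
    isTotalOrder : IsTotalOrder _≡_ _≤_
    _≤?_ : Decidable _≤_
    +-monoˡ-≤ : ∀ {x y} z → x ≤ y → x + z ≤ y + z
    *-nonneg : ∀ {x y} → 0# ≤ x → 0# ≤ y → 0# ≤ x * y
    0≤1 : 0# ≤ 1#
    sup : (P : ℝ → Set) → Σ ℝ P → Σ ℝ (λ b → ∀ x → P x → x ≤ b) →
          Σ ℝ (λ s → (∀ x → P x → x ≤ s) × (∀ b → (∀ x → P x → x ≤ b) → s ≤ b))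

record SetFunctor : Set₁ where
  field
    F : Set → Set
    fmap : ∀ {X Y : Set} → (X → Y) → F X → F Y
    fmap-id : ∀ {X : Set} (t : F X) → fmap id t ≡ t
    fmap-∘ : ∀ {X Y Z : Set} (g : Y → Z) (f : X → Y) (t : F X) →
             fmap (g ∘ f) t ≡ fmap g (fmap f t)

module UnitInterval (R : Reals) where
  open Reals R
  open IsCommutativeRing isCommutativeRing using (+-identityˡ; -‿inverseʳ; +-comm)
  open IsTotalOrder isTotalOrder using (total) renaming (refl to ≤-refl; trans to ≤-trans)

  V : Set
  V = Σ ℝ (λ x → (0# ≤ x) × (x ≤ 1#))

  _-ℝ_ : ℝ → ℝ → ℝ
  x -ℝ y = x + (- y)

  max0 : ℝ → ℝ
  max0 a with a ≤? 0#
  ... | yes _ = 0#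
  ... | no _ = a

  0≤max0 : ∀ a → 0# ≤ max0 a
  0≤max0 a with a ≤? 0#
  ... | yes _ = ≤-refl
  ... | no a≰0 with total a 0#
  ...   | inj₁ a≤0 = Relation.Nullary.contradiction a≤0 a≰0
    where import Relation.Nullary
  ...   | inj₂ 0≤a = 0≤a

  -≤ : ∀ q e → 0# ≤ e → q -ℝ e ≤ q
  -≤ q e 0≤e = subst (λ z → q + - e ≤ z) (+-identityˡ q) step2
    where
      step1 : - e ≤ 0#
      step1 = subst (λ z → z ≤ 0#) (+-identityˡ (- e))
                (subst (λ z → 0# + - e ≤ z) (-‿inverseʳ e) (+-monoˡ-≤ (- e) 0≤e))
      step2 : q + - e ≤ 0# + q
      step2 = subst (λ z → z ≤ 0# + q) (+-comm (- e) q) (+-monoˡ-≤ q step1)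

  max0-≤1 : ∀ q e → q ≤ 1# → 0# ≤ e → max0 (q -ℝ e) ≤ 1#
  max0-≤1 q e q≤1 0≤e with (q -ℝ e) ≤? 0#
  ... | yes _ = 0≤1
  ... | no _ = ≤-trans (-≤ q e 0≤e) q≤1

  _⊖_ : V → V → V
  (q , _ , q≤1) ⊖ (e , 0≤e , _) = max0 (q -ℝ e) , 0≤max0 (q -ℝ e) , max0-≤1 q e q≤1 0≤e

  _≤V_ : V → V → Set
  a ≤V b = proj₁ a ≤ proj₁ b

  record PredLifting (Fn : SetFunctor) : Set₁ where
    open SetFunctor Fn
    field
      lift : ∀ {X : Set} → (X → Bool) → F X → V
      natural : ∀ {X Y : Set} (f : X → Y) (A : Y → Bool) (t : F X) →
                proj₁ (lift (A ∘ f) t) ≡ proj₁ (lift A (fmap f t))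
      monotone : ∀ {X : Set} (A B : X → Bool) → (∀ x → A x ≡ true → B x ≡ true) →
                 ∀ t → lift A t ≤V lift B t

  -- two-valued formulae over a set Λ of liftings, indexed by L
  data Formula (L : Set) : Set where
    ⊥f ⊤f : Formula L
    _∧f_ _∨f_ : Formula L → Formula L → Formula L
    mod : L → V → Formula L → Formula L

  open import Data.Bool using (_∧_; _∨_)

  sat : (Fn : SetFunctor) (L : Set) (Λ : L → PredLifting Fn) {X : Set}
        (ξ : X → SetFunctor.F Fn X) (ε : V) → Formula L → X → Bool
  sat Fn L Λ ξ ε ⊥f x = false
  sat Fn L Λ ξ ε ⊤f x = true
  sat Fn L Λ ξ ε (φ ∧f ψ) x = sat Fn L Λ ξ ε φ x ∧ sat Fn L Λ ξ ε ψ x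
  sat Fn L Λ ξ ε (φ ∨f ψ) x = sat Fn L Λ ξ ε φ x ∨ sat Fn L Λ ξ ε ψ x
  sat Fn L Λ ξ ε (mod l q φ) x =
    ⌊ proj₁ (q ⊖ ε) ≤? proj₁ (PredLifting.lift (Λ l) (sat Fn L Λ ξ ε φ) (ξ x)) ⌋

  Sat : (Fn : SetFunctor) (L : Set) (Λ : L → PredLifting Fn) {X : Set}
        (ξ : X → SetFunctor.F Fn X) (ε : V) → Formula L → X → Set
  Sat Fn L Λ ξ ε φ x = sat Fn L Λ ξ ε φ x ≡ true

  relax : {L : Set} → V → Formula L → Formula L
  relax δ ⊥f = ⊥f
  relax δ ⊤f = ⊤f
  relax δ (φ ∧f ψ) = relax δ φ ∧f relax δ ψ
  relax δ (φ ∨f ψ) = relax δ φ ∨f relax δ ψ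
  relax δ (mod l q φ) = mod l (q ⊖ δ) (relax δ φ)

-- For δ ≤ ε truncated subtraction satisfies (q ⊖ δ) ⊖ (ε ⊖ δ) = q ⊖ ε, so relaxing every
-- modal threshold by δ exactly compensates for lowering the tolerance by δ. Monotone
-- liftings send pointwise equal predicates to equal values, hence induction on φ shows
-- that the two satisfaction predicates coincide pointwise.
module Submission where

open import Defs
open import Data.Bool using (Bool; _∧_; _∨_)
open import Data.Product using (proj₁)
open import Function.Bundles using (_⇔_; mk⇔)
open import Relation.Nullary using (yes; no; contradiction)
open import Relation.Nullary.Decidable using (⌊_⌋)
open import Relation.Binary.PropositionalEquality
  using (_≡_; refl; sym; trans; cong; cong₂; subst; subst₂; module ≡-Reasoning)
open import Relation.Binary.Structures using (IsTotalOrder)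
open import Algebra.Bundles using (AbelianGroup)
open import Algebra.Structures using (IsCommutativeRing)
import Algebra.Properties.AbelianGroup as AbelianGroupProperties

module TruncatedSubtraction (R : Reals) where
  open Reals R
  open UnitInterval R
  open IsCommutativeRing isCommutativeRing
    using (+-assoc; +-comm; -‿inverseʳ; +-isAbelianGroup)
  open IsTotalOrder isTotalOrder using (antisym) renaming (trans to ≤-trans)

  +-abelianGroup : AbelianGroup _ _
  +-abelianGroup = record { isAbelianGroup = +-isAbelianGroup }

  open AbelianGroupProperties +-abelianGroup using (⁻¹-anti-homo‿-; \\-leftDividesˡ; \\-leftDividesʳ)

  [a-b]-[c-b]≡a-c : ∀ a b c → (a -ℝ b) -ℝ (c -ℝ b) ≡ a -ℝ c
  [a-b]-[c-b]≡a-c a b c = begin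
    (a + - b) + - (c + - b)  ≡⟨ cong ((a + - b) +_) (⁻¹-anti-homo‿- c b) ⟩
    (a + - b) + (b + - c)    ≡⟨ +-assoc a (- b) (b + - c) ⟩
    a + (- b + (b + - c))    ≡⟨ cong (a +_) (\\-leftDividesʳ b (- c)) ⟩
    a + - c                  ∎
    where open ≡-Reasoning

  x≤y⇒0≤y-x : ∀ {x y} → x ≤ y → 0# ≤ y -ℝ x
  x≤y⇒0≤y-x {x} x≤y = subst (_≤ _) (-‿inverseʳ x) (+-monoˡ-≤ (- x) x≤y)

  neg-antimono-≤ : ∀ {x y} → x ≤ y → - y ≤ - x
  neg-antimono-≤ {x} {y} x≤y = subst₂ _≤_ x-x-y≡-y y-x-y≡-x (+-monoˡ-≤ (- x + - y) x≤y)
    where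
    x-x-y≡-y : x + (- x + - y) ≡ - y
    x-x-y≡-y = \\-leftDividesˡ x (- y)

    y-x-y≡-x : y + (- x + - y) ≡ - x
    y-x-y≡-x = trans (cong (y +_) (+-comm (- x) (- y))) (\\-leftDividesˡ y (- x))

  -ℝ-antimonoʳ-≤ : ∀ z {x y} → x ≤ y → z -ℝ y ≤ z -ℝ x
  -ℝ-antimonoʳ-≤ z x≤y =
    subst₂ _≤_ (+-comm _ z) (+-comm _ z) (+-monoˡ-≤ z (neg-antimono-≤ x≤y))

  max0-nonpos : ∀ {a} → a ≤ 0# → max0 a ≡ 0#
  max0-nonpos {a} a≤0 with a ≤? 0#
  ... | yes _   = refl
  ... | no  a≰0 = contradiction a≤0 a≰0

  max0-nonneg : ∀ {a} → 0# ≤ a → max0 a ≡ a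
  max0-nonneg {a} 0≤a with a ≤? 0#
  ... | yes a≤0 = antisym 0≤a a≤0
  ... | no  _   = refl

  max0-max0-sub : ∀ q {d e} → d ≤ e → max0 (max0 (q -ℝ d) -ℝ (e -ℝ d)) ≡ max0 (q -ℝ e)
  max0-max0-sub q {d} {e} d≤e with (q -ℝ d) ≤? 0#
  ... | yes q-d≤0 = trans (max0-nonpos (-≤ 0# (e -ℝ d) (x≤y⇒0≤y-x d≤e)))
                          (sym (max0-nonpos (≤-trans (-ℝ-antimonoʳ-≤ q d≤e) q-d≤0)))
  ... | no  _     = cong max0 ([a-b]-[c-b]≡a-c q d e)

  [q⊖δ]⊖[ε⊖δ]≡q⊖ε : ∀ q δ ε → δ ≤V ε → proj₁ ((q ⊖ δ) ⊖ (ε ⊖ δ)) ≡ proj₁ (q ⊖ ε)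
  [q⊖δ]⊖[ε⊖δ]≡q⊖ε q δ ε δ≤ε = begin
    max0 (max0 (q′ -ℝ d) -ℝ max0 (e -ℝ d)) ≡⟨ cong (λ z → max0 (max0 (q′ -ℝ d) -ℝ z))
                                                   (max0-nonneg (x≤y⇒0≤y-x δ≤ε)) ⟩
    max0 (max0 (q′ -ℝ d) -ℝ (e -ℝ d))      ≡⟨ max0-max0-sub q′ δ≤ε ⟩
    max0 (q′ -ℝ e)                         ∎
    where
    open ≡-Reasoning
    q′ d e : ℝ
    q′ = proj₁ q
    d = proj₁ δ
    e = proj₁ ε

module Relaxation (R : Reals) (Fn : SetFunctor) where
  open Reals R using (_≤?_)
  open UnitInterval R
  open TruncatedSubtraction R using ([q⊖δ]⊖[ε⊖δ]≡q⊖ε)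
  open IsTotalOrder (Reals.isTotalOrder R) using (antisym)

  lift-cong : (λ′ : PredLifting Fn) {X : Set} {A B : X → Bool} → (∀ x → A x ≡ B x) →
              ∀ t → proj₁ (PredLifting.lift λ′ A t) ≡ proj₁ (PredLifting.lift λ′ B t)
  lift-cong λ′ {A = A} {B} A≗B t = antisym
    (PredLifting.monotone λ′ A B (λ x Ax → trans (sym (A≗B x)) Ax) t)
    (PredLifting.monotone λ′ B A (λ x Bx → trans (A≗B x) Bx) t)

  sat-relax : (L : Set) (Λ : L → PredLifting Fn) {X : Set} (ξ : X → SetFunctor.F Fn X)
              {ε δ : V} → δ ≤V ε → ∀ φ x →
              sat Fn L Λ ξ ε φ x ≡ sat Fn L Λ ξ (ε ⊖ δ) (relax δ φ) x
  sat-relax L Λ ξ {ε} {δ} δ≤ε = go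
    where
    go : ∀ φ x → sat Fn L Λ ξ ε φ x ≡ sat Fn L Λ ξ (ε ⊖ δ) (relax δ φ) x
    go ⊥f        x = refl
    go ⊤f        x = refl
    go (φ ∧f ψ)  x = cong₂ _∧_ (go φ x) (go ψ x)
    go (φ ∨f ψ)  x = cong₂ _∨_ (go φ x) (go ψ x)
    go (mod l q φ) x = cong₂ (λ a b → ⌊ a ≤? b ⌋)
      (sym ([q⊖δ]⊖[ε⊖δ]≡q⊖ε q δ ε δ≤ε))
      (lift-cong (Λ l) (go φ) (ξ x))

lemma5p3 : (R : Reals) (Fn : SetFunctor) (L : Set)
           (Λ : L → UnitInterval.PredLifting R Fn)
           (X : Set) (ξ : X → SetFunctor.F Fn X)
           (ε δ : UnitInterval.V R) → UnitInterval._≤V_ R δ ε →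
           (x : X) (φ : UnitInterval.Formula R L) →
           UnitInterval.Sat R Fn L Λ ξ ε φ x
             ⇔ UnitInterval.Sat R Fn L Λ ξ (UnitInterval._⊖_ R ε δ)
                 (UnitInterval.relax R δ φ) x
lemma5p3 R Fn L Λ X ξ ε δ δ≤ε x φ = mk⇔ (trans (sym same)) (trans same)
  where same = Relaxation.sat-relax R Fn L Λ ξ δ≤ε φ x
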